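{- Let $d$ be a positive integer. Every bipartite graph $G$ on $n$ vertices with average degree at most $d$ contains an induced subgraph on at least $(\frac{1}{2}+\delta)n$ vertices, where $\delta=(2^7d^{2})^{ -4d}$, all of whose connected components are stars.
   Context: A star is a graph $K_{1,r}$ for some $r\ge 0$ (so a single vertex counts as a star). The average degree of a graph on $n$ vertices with $e$ edges is $2e/n$. -}

module Defs where

open import Data.Nat using (ℕ; zero; suc; _+_; _*_; _^_; _≤_; _<ᵇ_)
open import Data.Bool using (Bool; true; false; _∧_)
open import Data.Fin using (Fin; toℕ)
open import Data.Fin.Subset using (Subset; _∈_; ∣_∣)
open import Data.Vec using (Vec; tabulate; sum)
open import Data.Product using (Σ; ∃; _×_; _,_)
open import Data.Sum using (_⊎_)
open import Relation.Binary.PropositionalEquality using (_≡_; _≢_)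

record Graph (n : ℕ) : Set where
  field
    adj   : Fin n → Fin n → Bool
    sym   : ∀ i j → adj i j ≡ adj j i
    irref : ∀ i → adj i i ≡ false
open Graph public

Adj : ∀ {n} → Graph n → Fin n → Fin n → Set
Adj G i j = adj G i j ≡ true

edgeCount : ∀ {n} → Graph n → ℕ
edgeCount {n} G =
  sum (tabulate λ i → ∣ tabulate (λ j → (toℕ i <ᵇ toℕ j) ∧ adj G i j) ∣)

-- average degree 2e/n is at most d  (stated without division: 2e ≤ d·n)
AvgDegreeAtMost : ∀ {n} → Graph n → ℕ → Set
AvgDegreeAtMost {n} G d = 2 * edgeCount G ≤ d * n

Bipartite : ∀ {n} → Graph n → Set
Bipartite {n} G = Σ (Fin n → Bool) λ c → ∀ i j → Adj G i j → c i ≢ c j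

data Reach {n} (G : Graph n) (S : Subset n) : Fin n → Fin n → Set where
  here : ∀ {u} → u ∈ S → Reach G S u u
  step : ∀ {u v w} → Reach G S u v → w ∈ S → Adj G v w → Reach G S u w

Component : ∀ {n} → Graph n → Subset n → Fin n → Fin n → Set
Component G S v w = Reach G S v w

InducesStar : ∀ {n} → Graph n → (Fin n → Set) → Set
InducesStar {n} G C =
  Σ (Fin n) λ c → C c
    × (∀ v → C v → v ≢ c → Adj G c v)
    × (∀ u v → C u → C v → Adj G u v → (u ≡ c ⊎ v ≡ c))

StarForest : ∀ {n} → Graph n → Subset n → Set
StarForest {n} G S = ∀ v → v ∈ S → InducesStar G (Component G S v)

-- δ = (2^7 d^2)^(-4d) = 1 / deltaDen d
deltaDen : ℕ → ℕ
deltaDen d = (2 ^ 7 * (d * d)) ^ (4 * d)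

-- |S| ≥ (1/2 + 1/M) n  ⇔  2·M·|S| ≥ M·n + 2·n
LargeEnough : ℕ → ℕ → ℕ → Set
LargeEnough d n s = deltaDen d * n + 2 * n ≤ 2 * deltaDen d * s

module Submission where

-- Let X (colour true) and Y be the sides of G, D = 4d, and fix a threshold
-- E ≥ 1 with P = D·E; a vertex is rich, medium or light if its degree is ≥ P,
-- in [E, P) or < E.  Keep the non-rich X-vertices and a set T of Y-vertices of
-- degree < D without medium neighbours, chosen greedily so that no two share
-- a light neighbour ('Greedy').  Each X-vertex of the kept set S then has at
-- most one neighbour in S, so G[S] is a star forest ('StarCriterion').
-- Double counting ('OneSide') and adding the same construction with the
-- sides exchanged ('BothSides') gives
--   P n + n ≤ P (|S₁| + |S₂|) + Σ_v layerCost(deg v) + #{v : deg v ≥ D}.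
-- Over the 6d thresholds E = D^k the layer costs of a vertex sum to at most
-- 3·deg ('layer-sum'), so some threshold has total cost ≤ n/2 ('good-layer'),
-- and #{deg ≥ D} ≤ n/4 ('markov').  So the larger of S₁, S₂ has at least
-- (1/2 + 1/(8P)) n vertices, where 8P ≤ 8(4d)^(6d) ≤ (2^7 d²)^(4d).

open import Defs hiding (sym)
open import Data.Nat using (ℕ; _≤_)
open import Data.Fin.Subset using (Subset; ∣_∣)
open import Data.Product using (Σ; _×_)

open import Data.Nat using (zero; suc; _+_; _*_; _^_; _<_; _≤ᵇ_; _<ᵇ_; z≤n; s≤s; _≤?_)
open import Data.Nat.Properties hiding (_≟_)
open import Data.Nat.Solver using (module +-*-Solver)
open import Data.Bool using (Bool; true; false; _∧_; _∨_; not; if_then_else_)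
open import Data.Bool.Properties using (T-≡; ∧-assoc; ∧-zeroʳ; ∨-zeroʳ; not-injective)
open import Data.Fin as F using (Fin; toℕ)
open import Data.Fin.Properties using (toℕ-injective; _≟_)
open import Data.Fin.Subset using (_∈_)
open import Data.Vec using (tabulate)
import Data.Vec as Vec
open import Data.Vec.Properties using (lookup∘tabulate; []=⇒lookup; lookup⇒[]=)
open import Data.List using (List; []; _∷_; allFin)
open import Data.List.Membership.Propositional using () renaming (_∈_ to _∈ₗ_)
open import Data.List.Membership.Propositional.Properties using (∈-allFin)
open import Data.List.Relation.Unary.Any using (here; there)
open import Data.Product using (_,_; proj₁; proj₂; ∃)
open import Data.Sum using (_⊎_; inj₁; inj₂)
open import Data.Empty using (⊥-elim)
open import Function using (_∘_)
open import Function.Bundles using (Equivalence)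
open import Relation.Nullary using (¬_; Dec; yes; no; does)
open import Relation.Binary using (tri<; tri≈; tri>)
open import Relation.Binary.PropositionalEquality
  using (_≡_; _≢_; refl; sym; trans; cong; cong₂; subst; module ≡-Reasoning)

open +-*-Solver using (solve; _:+_; _:*_; _:=_; con)

∑ : ∀ {n} → (Fin n → ℕ) → ℕ
∑ {zero}  f = 0
∑ {suc n} f = f F.zero + ∑ (f ∘ F.suc)

∑-cong : ∀ {n} {f g : Fin n → ℕ} → (∀ i → f i ≡ g i) → ∑ f ≡ ∑ g
∑-cong {zero}  h = refl
∑-cong {suc n} h = cong₂ _+_ (h F.zero) (∑-cong (h ∘ F.suc))

∑-mono : ∀ {n} {f g : Fin n → ℕ} → (∀ i → f i ≤ g i) → ∑ f ≤ ∑ g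
∑-mono {zero}  h = z≤n
∑-mono {suc n} h = +-mono-≤ (h F.zero) (∑-mono (h ∘ F.suc))

∑-+ : ∀ {n} (f g : Fin n → ℕ) → ∑ (λ i → f i + g i) ≡ ∑ f + ∑ g
∑-+ {zero}  f g = refl
∑-+ {suc n} f g = begin
  f F.zero + g F.zero + ∑ (λ i → f (F.suc i) + g (F.suc i))
    ≡⟨ cong (f F.zero + g F.zero +_) (∑-+ (f ∘ F.suc) (g ∘ F.suc)) ⟩
  f F.zero + g F.zero + (∑ (f ∘ F.suc) + ∑ (g ∘ F.suc))
    ≡⟨ solve 4 (λ a b c e → a :+ b :+ (c :+ e) := a :+ c :+ (b :+ e)) refl
         (f F.zero) (g F.zero) (∑ (f ∘ F.suc)) (∑ (g ∘ F.suc)) ⟩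
  f F.zero + ∑ (f ∘ F.suc) + (g F.zero + ∑ (g ∘ F.suc)) ∎
  where open ≡-Reasoning

∑-*ˡ : ∀ {n} c (f : Fin n → ℕ) → ∑ (λ i → c * f i) ≡ c * ∑ f
∑-*ˡ {zero}  c f = sym (*-zeroʳ c)
∑-*ˡ {suc n} c f =
  trans (cong (c * f F.zero +_) (∑-*ˡ c (f ∘ F.suc))) (sym (*-distribˡ-+ c (f F.zero) _))

∑-const : ∀ {n} c → ∑ {n} (λ _ → c) ≡ n * c
∑-const {zero}  c = refl
∑-const {suc n} c = cong (c +_) (∑-const {n} c)

∑-zero : ∀ {n} → ∑ {n} (λ _ → 0) ≡ 0
∑-zero {n} = trans (∑-const {n} 0) (*-zeroʳ n)

∑-swap : ∀ {m n} (f : Fin m → Fin n → ℕ) →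
         ∑ (λ i → ∑ (λ j → f i j)) ≡ ∑ (λ j → ∑ (λ i → f i j))
∑-swap {zero} {n} f = sym (∑-zero {n})
∑-swap {suc m} f = trans (cong (∑ (f F.zero) +_) (∑-swap (f ∘ F.suc)))
                         (sym (∑-+ (f F.zero) (λ j → ∑ (λ i → f (F.suc i) j))))

≤-∑ : ∀ {n} (f : Fin n → ℕ) i → f i ≤ ∑ f
≤-∑ f F.zero    = m≤m+n _ _
≤-∑ f (F.suc i) = ≤-trans (≤-∑ (f ∘ F.suc) i) (m≤n+m _ _)

⟦_⟧ : Bool → ℕ
⟦ true  ⟧ = 1
⟦ false ⟧ = 0

⟦∧⟧ : ∀ a b → ⟦ a ∧ b ⟧ ≡ ⟦ a ⟧ * ⟦ b ⟧
⟦∧⟧ true  b = sym (+-identityʳ _)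
⟦∧⟧ false b = refl

⟦⟧-split : ∀ b c → ⟦ b ∧ c ⟧ + ⟦ not b ∧ c ⟧ ≡ ⟦ c ⟧
⟦⟧-split true  c = +-identityʳ _
⟦⟧-split false c = refl

⟦⟧-split₁ : ∀ b → ⟦ b ⟧ + ⟦ not b ⟧ ≡ 1
⟦⟧-split₁ true  = refl
⟦⟧-split₁ false = refl

∧-true : ∀ {a b} → a ∧ b ≡ true → (a ≡ true) × (b ≡ true)
∧-true {true} {true} _ = refl , refl

∨-true : ∀ {a b} → a ∨ b ≡ true → (a ≡ true) ⊎ (b ≡ true)
∨-true {true}  _ = inj₁ refl
∨-true {false} q = inj₂ q

true≢false : true ≢ false
true≢false ()

≤ᵇ-sound : ∀ {m n} → (m ≤ᵇ n) ≡ true → m ≤ n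
≤ᵇ-sound {m} {n} e = ≤ᵇ⇒≤ m n (Equivalence.from T-≡ e)

≤ᵇ-complete : ∀ {m n} → m ≤ n → (m ≤ᵇ n) ≡ true
≤ᵇ-complete p = Equivalence.to T-≡ (≤⇒≤ᵇ p)

<ᵇ-sound : ∀ {m n} → (m <ᵇ n) ≡ true → m < n
<ᵇ-sound {m} {n} e = <ᵇ⇒< m n (Equivalence.from T-≡ e)

<ᵇ-complete : ∀ {m n} → m < n → (m <ᵇ n) ≡ true
<ᵇ-complete p = Equivalence.to T-≡ (<⇒<ᵇ p)

≤ᵇ-false : ∀ {m n} → (m ≤ᵇ n) ≡ false → n < m
≤ᵇ-false {m} {n} e with m ≤? n
... | yes p = ⊥-elim (true≢false (trans (sym (≤ᵇ-complete p)) e))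
... | no ¬p = ≰⇒> ¬p

<ᵇ-false : ∀ {m n} → (m <ᵇ n) ≡ false → n ≤ m
<ᵇ-false {m} {n} e with m <? n
... | yes p = ⊥-elim (true≢false (trans (sym (<ᵇ-complete p)) e))
... | no ¬p = ≮⇒≥ ¬p

<ᵇ-refute : ∀ {m n} → ¬ m < n → (m <ᵇ n) ≡ false
<ᵇ-refute {m} {n} ¬p with m <ᵇ n in e
... | true  = ⊥-elim (¬p (<ᵇ-sound e))
... | false = refl

∣tabulate∣ : ∀ {n} (s : Fin n → Bool) → ∣ tabulate s ∣ ≡ ∑ (λ i → ⟦ s i ⟧)
∣tabulate∣ {zero}  s = refl
∣tabulate∣ {suc n} s with s F.zero
... | true  = cong suc (∣tabulate∣ (s ∘ F.suc))
... | false = ∣tabulate∣ (s ∘ F.suc)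

∈-tabulate⁻ : ∀ {n} (s : Fin n → Bool) i → i ∈ tabulate s → s i ≡ true
∈-tabulate⁻ s i p = trans (sym (lookup∘tabulate s i)) ([]=⇒lookup p)

∈-tabulate⁺ : ∀ {n} (s : Fin n → Bool) i → s i ≡ true → i ∈ tabulate s
∈-tabulate⁺ s i p = lookup⇒[]= i (tabulate s) (trans (lookup∘tabulate s i) p)

any : ∀ {n} → (Fin n → Bool) → Bool
any {zero}  f = false
any {suc n} f = f F.zero ∨ any (f ∘ F.suc)

any-intro : ∀ {n} (f : Fin n → Bool) i → f i ≡ true → any f ≡ true
any-intro f F.zero    p rewrite p = refl
any-intro f (F.suc i) p rewrite any-intro (f ∘ F.suc) i p = ∨-zeroʳ (f F.zero)

any-elim : ∀ {n} (f : Fin n → Bool) → any f ≡ true → ∃ λ i → f i ≡ true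
any-elim {suc n} f p with ∨-true {f F.zero} p
... | inj₁ q = F.zero , q
... | inj₂ q with any-elim (f ∘ F.suc) q
...   | i , r = F.suc i , r

any-cong : ∀ {n} {f g : Fin n → Bool} → (∀ i → f i ≡ g i) → any f ≡ any g
any-cong {zero}  h = refl
any-cong {suc n} h = cong₂ _∨_ (h F.zero) (any-cong (h ∘ F.suc))

⟦any⟧≤∑ : ∀ {n} (f : Fin n → Bool) → ⟦ any f ⟧ ≤ ∑ (λ i → ⟦ f i ⟧)
⟦any⟧≤∑ f with any f in e
... | false = z≤n
... | true with any-elim f e
...   | i , q = subst (λ b → ⟦ b ⟧ ≤ ∑ (λ i → ⟦ f i ⟧)) q
                      (≤-∑ (λ i → ⟦ f i ⟧) i)

deg : ∀ {n} → Graph n → Fin n → ℕ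
deg G v = ∑ (λ u → ⟦ adj G v u ⟧)

handshake : ∀ {n} (G : Graph n) → ∑ (deg G) ≡ 2 * edgeCount G
handshake {n} G = begin
  ∑ (λ i → ∑ (λ j → ⟦ adj G i j ⟧))
    ≡⟨ ∑-cong (λ i → trans (∑-cong (λ j → split i j)) (∑-+ (up i) (λ j → up j i))) ⟩
  ∑ (λ i → ∑ (up i) + ∑ (λ j → up j i))
    ≡⟨ ∑-+ (λ i → ∑ (up i)) (λ i → ∑ (λ j → up j i)) ⟩
  ∑ (λ i → ∑ (up i)) + ∑ (λ i → ∑ (λ j → up j i))
    ≡⟨ cong (∑ (λ i → ∑ (up i)) +_) (sym (∑-swap up)) ⟩
  ∑ (λ i → ∑ (up i)) + ∑ (λ i → ∑ (up i))
    ≡⟨ cong (λ x → x + x) (sym edges) ⟩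
  edgeCount G + edgeCount G
    ≡⟨ cong (edgeCount G +_) (sym (+-identityʳ _)) ⟩
  2 * edgeCount G ∎
  where
  open ≡-Reasoning
  upward : Fin n → Fin n → Bool
  upward i j = (toℕ i <ᵇ toℕ j) ∧ adj G i j
  up : Fin n → Fin n → ℕ
  up i j = ⟦ upward i j ⟧
  edges : edgeCount G ≡ ∑ (λ i → ∑ (up i))
  edges = trans (sum-tabulate (λ i → ∣ tabulate (upward i) ∣)) (∑-cong (λ i → ∣tabulate∣ (upward i)))
    where
    sum-tabulate : ∀ {m} (f : Fin m → ℕ) → Vec.sum (tabulate f) ≡ ∑ f
    sum-tabulate {zero}  f = refl
    sum-tabulate {suc m} f = cong (f F.zero +_) (sum-tabulate (f ∘ F.suc))
  split : ∀ i j → ⟦ adj G i j ⟧ ≡ up i j + up j i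
  split i j with <-cmp (toℕ i) (toℕ j)
  ... | tri< i<j _ ¬j<i rewrite <ᵇ-complete i<j | <ᵇ-refute ¬j<i = sym (+-identityʳ _)
  ... | tri> ¬i<j _ j<i rewrite <ᵇ-complete j<i | <ᵇ-refute ¬i<j | Graph.sym G j i = refl
  ... | tri≈ ¬i<j i≡j ¬j<i
    rewrite <ᵇ-refute ¬i<j | <ᵇ-refute ¬j<i | toℕ-injective i≡j | irref G j = refl

module StarCriterion {n} (G : Graph n) (col : Fin n → Bool)
                     (proper : ∀ i j → Adj G i j → col i ≢ col j) where

  adj-sym : ∀ {i j} → Adj G i j → Adj G j i
  adj-sym {i} {j} e = trans (Graph.sym G j i) e

  opposite : ∀ {u v} → Adj G u v → col v ≡ not (col u)
  opposite {u} {v} e with col u | col v | proper u v e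
  ... | true  | true  | ne = ⊥-elim (ne refl)
  ... | true  | false | _  = refl
  ... | false | true  | _  = refl
  ... | false | false | ne = ⊥-elim (ne refl)

  reach-∈ : ∀ {S v w} → Reach G S v w → w ∈ S
  reach-∈ (here p)     = p
  reach-∈ (step _ p _) = p

  -- A vertex set all of whose members are the centre c or neighbours of c
  -- induces a star: two neighbours of c have equal colour, so are not adjacent.
  star : (C : Fin n → Set) (c : Fin n) → C c →
         (∀ w → C w → w ≡ c ⊎ Adj G c w) → InducesStar G C
  star C c cc leaf = c , cc , spoke , through-centre
    where
    spoke : ∀ v → C v → v ≢ c → Adj G c v
    spoke v cv v≢c with leaf v cv
    ... | inj₁ v≡c = ⊥-elim (v≢c v≡c)
    ... | inj₂ cv′ = cv′
    through-centre : ∀ u v → C u → C v → Adj G u v → (u ≡ c ⊎ v ≡ c)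
    through-centre u v cu cv e with leaf u cu | leaf v cv
    ... | inj₁ u≡c | _        = inj₁ u≡c
    ... | inj₂ _   | inj₁ v≡c = inj₂ v≡c
    ... | inj₂ cu′ | inj₂ cv′ =
      ⊥-elim (proper u v e (trans (opposite cu′) (sym (opposite cv′))))

  -- Components are stars centred at a vertex of colour false, or isolated.
  star-forest : (s : Fin n → Bool) →
    (∀ a u w → s a ≡ true → col a ≡ true → s u ≡ true → s w ≡ true →
       Adj G a u → Adj G a w → u ≡ w) →
    StarForest G (tabulate s)
  star-forest s unique v v∈S with col v in cv | any (λ t → adj G v t ∧ s t) in nbr
  ... | false | _ = star (Component G S v) v (here v∈S) centred-at-v
    where
    S = tabulate s
    centred-at-v : ∀ w → Reach G S v w → w ≡ v ⊎ Adj G v w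
    centred-at-v w (here _) = inj₁ refl
    centred-at-v w (step {v = u} r w∈S uw) with centred-at-v u r
    ... | inj₁ refl = inj₂ uw
    ... | inj₂ vu   = inj₁ (sym (unique u v w (∈-tabulate⁻ s u (reach-∈ r))
                       (trans (opposite vu) (cong not cv)) (∈-tabulate⁻ s v v∈S)
                       (∈-tabulate⁻ s w w∈S) (adj-sym vu) uw))
  ... | true | false = star (Component G S v) v (here v∈S) (λ w r → inj₁ (isolated w r))
    where
    S = tabulate s
    isolated : ∀ w → Reach G S v w → w ≡ v
    isolated w (here _) = refl
    isolated w (step {v = u} r w∈S uw) with isolated u r
    ... | refl = ⊥-elim (true≢false (trans (sym (any-intro (λ t → adj G v t ∧ s t) w
                   (cong₂ _∧_ uw (∈-tabulate⁻ s w w∈S)))) nbr))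
  ... | true | true with any-elim (λ t → adj G v t ∧ s t) nbr
  ...   | t , vt∧t∈S = star (Component G S v) t (step (here v∈S) t∈S vt) centred-at-t
    where
    S = tabulate s
    vt : Adj G v t
    vt = proj₁ (∧-true vt∧t∈S)
    t∈S : t ∈ S
    t∈S = ∈-tabulate⁺ s t (proj₂ (∧-true vt∧t∈S))
    centred-at-t : ∀ w → Reach G S v w → w ≡ t ⊎ Adj G t w
    centred-at-t w (here _) = inj₂ (adj-sym vt)
    centred-at-t w (step {v = u} r w∈S uw) with centred-at-t u r
    ... | inj₁ refl = inj₂ uw
    ... | inj₂ tu   = inj₁ (sym (unique u t w (∈-tabulate⁻ s u (reach-∈ r))
                       (trans (opposite tu) (cong not (trans (opposite vt) (cong not cv))))
                       (proj₂ (∧-true vt∧t∈S)) (∈-tabulate⁻ s w w∈S) (adj-sym tu) uw))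

-- Scanning the
-- vertices and keeping every candidate that conflicts with none kept so far
-- gives a set 'chosen' of candidates that is pairwise conflict-free and
-- dominates the candidates: each is chosen or conflicts with a chosen one.
module Greedy {n} (candidate : Fin n → Bool) (conflict : Fin n → Fin n → Bool)
              (conflict-sym : ∀ a b → conflict a b ≡ conflict b a) where

  same : Fin n → Fin n → Bool
  same v x = does (v ≟ x)

  same-refl : ∀ x → same x x ≡ true
  same-refl x with x ≟ x
  ... | yes _ = refl
  ... | no ne = ⊥-elim (ne refl)

  same-sound : ∀ v x → same v x ≡ true → v ≡ x
  same-sound v x e with v ≟ x
  ... | yes v≡x = v≡x

  ∑-same : ∀ (t : Fin n) → ∑ (λ v → ⟦ same v t ⟧) ≡ 1
  ∑-same t = count t
    where
    count : ∀ {m} (t : Fin m) → ∑ (λ v → ⟦ does (v ≟ t) ⟧) ≡ 1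
    count {suc m} F.zero    = cong suc (∑-zero {m})
    count {suc m} (F.suc t) = trans (∑-cong shift) (count t)
      where
      shift : ∀ v → ⟦ does (F.suc v ≟ F.suc t) ⟧ ≡ ⟦ does (v ≟ t) ⟧
      shift v with v ≟ t
      ... | yes _ = refl
      ... | no _  = refl

  free : (Fin n → Bool) → Fin n → Bool
  free kept x = not (any (λ y → kept y ∧ conflict y x))

  free-sound : ∀ kept x → free kept x ≡ true → ∀ y → kept y ≡ true → conflict y x ≡ false
  free-sound kept x fr y ky with conflict y x in e
  ... | false = refl
  ... | true  = ⊥-elim (true≢false (sym (trans (sym (cong not
                  (any-intro (λ y → kept y ∧ conflict y x) y (cong₂ _∧_ ky e)))) fr)))

  free-complete : ∀ kept x → free kept x ≡ false →
                  ∃ λ y → (kept y ≡ true) × (conflict y x ≡ true)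
  free-complete kept x fr with any (λ y → kept y ∧ conflict y x) in e
  ... | true = let (y , q) = any-elim _ e in y , ∧-true q

  -- keep xs: the vertices kept after scanning xs from its last element
  keep : List (Fin n) → Fin n → Bool
  keep [] v = false
  keep (x ∷ xs) v with candidate x ∧ free (keep xs) x
  ... | true  = same v x ∨ keep xs v
  ... | false = keep xs v

  keep-candidate : ∀ xs y → keep xs y ≡ true → candidate y ≡ true
  keep-candidate (x ∷ xs) y k with candidate x ∧ free (keep xs) x in e
  ... | false = keep-candidate xs y k
  ... | true with ∨-true k
  ...   | inj₂ q = keep-candidate xs y q
  ...   | inj₁ q rewrite same-sound y x q = proj₁ (∧-true e)

  keep-grows : ∀ x xs y → keep xs y ≡ true → keep (x ∷ xs) y ≡ true
  keep-grows x xs y k with candidate x ∧ free (keep xs) x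
  ... | false = k
  ... | true rewrite k = ∨-zeroʳ (same y x)

  keep-independent : ∀ xs y z → keep xs y ≡ true → keep xs z ≡ true → y ≢ z →
                     conflict y z ≡ false
  keep-independent (x ∷ xs) y z ky kz y≢z with candidate x ∧ free (keep xs) x in e
  ... | false = keep-independent xs y z ky kz y≢z
  ... | true with ∨-true ky | ∨-true kz
  ...   | inj₂ a | inj₂ b = keep-independent xs y z a b y≢z
  ...   | inj₁ a | inj₁ b = ⊥-elim (y≢z (trans (same-sound y x a) (sym (same-sound z x b))))
  ...   | inj₁ a | inj₂ b rewrite same-sound y x a =
          trans (conflict-sym x z) (free-sound (keep xs) x (proj₂ (∧-true e)) z b)
  ...   | inj₂ a | inj₁ b rewrite same-sound z x b =
          free-sound (keep xs) x (proj₂ (∧-true e)) y a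

  keep-dominates : ∀ xs x → x ∈ₗ xs → candidate x ≡ true →
                   ∃ λ t → (keep xs t ≡ true) × (x ≡ t ⊎ conflict t x ≡ true)
  keep-dominates (y ∷ xs) x (there m) cx with keep-dominates xs x m cx
  ... | t , kt , r = t , keep-grows y xs t kt , r
  keep-dominates (x ∷ xs) x (here refl) cx with candidate x ∧ free (keep xs) x in e
  ... | true = x , cong (_∨ keep xs x) (same-refl x) , inj₁ refl
  ... | false rewrite cx with free-complete (keep xs) x e
  ...   | y , ky , c = y , ky , inj₂ c

  chosen : Fin n → Bool
  chosen = keep (allFin n)

  chosen-candidate : ∀ y → chosen y ≡ true → candidate y ≡ true
  chosen-candidate = keep-candidate (allFin n)

  chosen-independent : ∀ y z → chosen y ≡ true → chosen z ≡ true → y ≢ z →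
                       conflict y z ≡ false
  chosen-independent = keep-independent (allFin n)

  covers : Fin n → Fin n → ℕ
  covers t v = ⟦ same v t ⟧ + ⟦ conflict t v ⟧

  ∑-covers : ∀ t → ∑ (covers t) ≡ 1 + ∑ (λ v → ⟦ conflict t v ⟧)
  ∑-covers t = trans (∑-+ (λ v → ⟦ same v t ⟧) (λ v → ⟦ conflict t v ⟧))
                     (cong (_+ ∑ (λ v → ⟦ conflict t v ⟧)) (∑-same t))

  dominated : ∀ v → ⟦ candidate v ⟧ ≤ ∑ (λ t → ⟦ chosen t ⟧ * covers t v)
  dominated v with candidate v in cv
  ... | false = z≤n
  ... | true with keep-dominates (allFin n) v (∈-allFin v) cv
  ...   | t , ct , r = ≤-trans (one r) (≤-∑ (λ t → ⟦ chosen t ⟧ * covers t v) t)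
    where
    one : (v ≡ t ⊎ conflict t v ≡ true) → 1 ≤ ⟦ chosen t ⟧ * covers t v
    one (inj₁ refl) rewrite ct | same-refl v = s≤s z≤n
    one (inj₂ c)    rewrite ct | c = ≤-trans (m≤n+m 1 _) (m≤m+n _ 0)

  greedy-count : (U : ℕ) → (∀ t → candidate t ≡ true → ∑ (covers t) ≤ U) →
                 ∑ (λ v → ⟦ candidate v ⟧) ≤ U * ∑ (λ t → ⟦ chosen t ⟧)
  greedy-count U bound = begin
    ∑ (λ v → ⟦ candidate v ⟧)                      ≤⟨ ∑-mono dominated ⟩
    ∑ (λ v → ∑ (λ t → ⟦ chosen t ⟧ * covers t v))  ≡⟨ ∑-swap (λ v t → ⟦ chosen t ⟧ * covers t v) ⟩
    ∑ (λ t → ∑ (λ v → ⟦ chosen t ⟧ * covers t v))  ≡⟨ ∑-cong (λ t → ∑-*ˡ ⟦ chosen t ⟧ (covers t)) ⟩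
    ∑ (λ t → ⟦ chosen t ⟧ * ∑ (covers t))          ≤⟨ ∑-mono each ⟩
    ∑ (λ t → U * ⟦ chosen t ⟧)                     ≡⟨ ∑-*ˡ U (λ t → ⟦ chosen t ⟧) ⟩
    U * ∑ (λ t → ⟦ chosen t ⟧)                     ∎
    where
    open ≤-Reasoning
    each : ∀ t → ⟦ chosen t ⟧ * ∑ (covers t) ≤ U * ⟦ chosen t ⟧
    each t with chosen t in ct
    ... | false = z≤n
    ... | true  = ≤-trans (≤-reflexive (+-identityʳ _))
                    (≤-trans (bound t (chosen-candidate t ct)) (≤-reflexive (sym (*-identityʳ U))))

-- One side of the construction: X is the colour class 'true', Y its
-- complement, E ≥ 1 a degree threshold and P = D·E.
module OneSide {n} (G : Graph n) (col : Fin n → Bool)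
               (proper : ∀ i j → Adj G i j → col i ≢ col j)
               (D E : ℕ) (E≥1 : 1 ≤ E) where

  open StarCriterion G col proper using (adj-sym; opposite; star-forest)

  P : ℕ
  P = D * E

  dg : Fin n → ℕ
  dg = deg G

  rich medium light : Fin n → Bool
  rich   a = P ≤ᵇ dg a
  medium a = (E ≤ᵇ dg a) ∧ (dg a <ᵇ P)
  light  a = dg a <ᵇ E

  medium-nbr : Fin n → Bool
  medium-nbr t = any (λ a → adj G t a ∧ medium a)

  candidate : Fin n → Bool
  candidate t = not (col t) ∧ ((dg t <ᵇ D) ∧ not (medium-nbr t))

  conflict : Fin n → Fin n → Bool
  conflict t v = any (λ a → adj G t a ∧ (light a ∧ adj G a v))

  conflict-sym : ∀ t v → conflict t v ≡ conflict v t
  conflict-sym t v = any-cong λ a →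
    trans (reorder (adj G t a) (light a) (adj G a v))
          (cong₂ (λ x y → x ∧ (light a ∧ y)) (Graph.sym G a v) (Graph.sym G t a))
    where
    reorder : ∀ p q r → p ∧ (q ∧ r) ≡ r ∧ (q ∧ p)
    reorder true  q true  = refl
    reorder true  q false = ∧-zeroʳ q
    reorder false q true  = sym (∧-zeroʳ q)
    reorder false q false = refl

  open Greedy candidate conflict conflict-sym
    using (chosen; chosen-candidate; chosen-independent; covers; ∑-covers; greedy-count)

  inS : Fin n → Bool
  inS v = (col v ∧ not (rich v)) ∨ chosen v

  not-true : ∀ {b} → not b ≡ true → b ≡ false
  not-true {false} _ = refl

  chosen-in-Y : ∀ v → chosen v ≡ true → col v ≡ false
  chosen-in-Y v ch = not-true (proj₁ (∧-true (chosen-candidate v ch)))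

  candidate-degree : ∀ t → candidate t ≡ true → dg t < D
  candidate-degree t c =
    <ᵇ-sound {dg t} (proj₁ (∧-true {dg t <ᵇ D} (proj₂ (∧-true {not (col t)} c))))

  candidate-no-medium : ∀ t → candidate t ≡ true → medium-nbr t ≡ false
  candidate-no-medium t c = not-true (proj₂ (∧-true {dg t <ᵇ D} (proj₂ (∧-true {not (col t)} c))))

  light-otherwise : ∀ a → rich a ≡ false → medium a ≡ false → light a ≡ true
  light-otherwise a r m with E ≤ᵇ dg a in e
  ... | false = <ᵇ-complete (≤ᵇ-false {E} e)
  ... | true  = ⊥-elim (true≢false (trans (sym (<ᵇ-complete (≤ᵇ-false {P} r))) m))

  -- The S-neighbours of an X-vertex a ∈ S are chosen candidates; a is
  -- neither rich (it is in S) nor medium (it is adjacent to a candidate), so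
  -- it is light and two distinct S-neighbours of a would conflict.
  forest : StarForest G (tabulate inS)
  forest = star-forest inS at-most-one
    where
    at-most-one : ∀ a u w → inS a ≡ true → col a ≡ true → inS u ≡ true → inS w ≡ true →
                  Adj G a u → Adj G a w → u ≡ w
    at-most-one a u w a∈S Xa u∈S w∈S au aw with u ≟ w
    ... | yes u≡w = u≡w
    ... | no u≢w  = ⊥-elim (true≢false (trans (sym conflict-uw) (chosen-independent u w cu cw u≢w)))
      where
      chosen-nbr : ∀ x → Adj G a x → inS x ≡ true → chosen x ≡ true
      chosen-nbr x ax x∈S = trans (cong (λ b → (b ∧ not (rich x)) ∨ chosen x)
                                        (sym (trans (opposite ax) (cong not Xa)))) x∈S
      cu = chosen-nbr u au u∈S
      cw = chosen-nbr w aw w∈S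
      a-not-chosen : chosen a ≡ false
      a-not-chosen with chosen a in ch
      ... | false = refl
      ... | true  = ⊥-elim (true≢false (trans (sym Xa) (chosen-in-Y a ch)))
      a-not-rich : rich a ≡ false
      a-not-rich = kept (rich a) (chosen a)
                     (trans (cong (λ b → (b ∧ not (rich a)) ∨ chosen a) (sym Xa)) a∈S) a-not-chosen
        where
        kept : ∀ r c → not r ∨ c ≡ true → c ≡ false → r ≡ false
        kept false c _    _  = refl
        kept true  true _ ()
      a-not-medium : medium a ≡ false
      a-not-medium with medium a in m
      ... | false = refl
      ... | true  = ⊥-elim (true≢false (trans (sym (any-intro (λ b → adj G u b ∧ medium b) a
                      (cong₂ _∧_ (adj-sym au) m))) (candidate-no-medium u (chosen-candidate u cu))))
      conflict-uw : conflict u w ≡ true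
      conflict-uw = any-intro _ a (cong₂ _∧_ (adj-sym au)
                      (cong₂ _∧_ (light-otherwise a a-not-rich a-not-medium) aw))

  -- A vertex t conflicts with at most E·deg t vertices: paths t – a – v
  -- through light vertices a.
  conflicts-bound : ∀ t → ∑ (λ v → ⟦ conflict t v ⟧) ≤ E * dg t
  conflicts-bound t = begin
    ∑ (λ v → ⟦ conflict t v ⟧)                  ≤⟨ ∑-mono (λ v → ⟦any⟧≤∑ (path v)) ⟩
    ∑ (λ v → ∑ (λ a → ⟦ path v a ⟧))            ≡⟨ ∑-swap (λ v a → ⟦ path v a ⟧) ⟩
    ∑ (λ a → ∑ (λ v → ⟦ path v a ⟧))            ≡⟨ ∑-cong paths-through ⟩
    ∑ (λ a → ⟦ adj G t a ∧ light a ⟧ * dg a)    ≤⟨ ∑-mono light-term ⟩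
    ∑ (λ a → E * ⟦ adj G t a ⟧)                 ≡⟨ ∑-*ˡ E (λ a → ⟦ adj G t a ⟧) ⟩
    E * dg t                                    ∎
    where
    open ≤-Reasoning
    path : Fin n → Fin n → Bool
    path v a = adj G t a ∧ (light a ∧ adj G a v)
    paths-through : ∀ a → ∑ (λ v → ⟦ path v a ⟧) ≡ ⟦ adj G t a ∧ light a ⟧ * dg a
    paths-through a = trans (∑-cong split) (∑-*ˡ ⟦ adj G t a ∧ light a ⟧ (λ v → ⟦ adj G a v ⟧))
      where
      split : ∀ v → ⟦ path v a ⟧ ≡ ⟦ adj G t a ∧ light a ⟧ * ⟦ adj G a v ⟧
      split v = trans (cong ⟦_⟧ (sym (∧-assoc (adj G t a) (light a) (adj G a v))))
                      (⟦∧⟧ (adj G t a ∧ light a) (adj G a v))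
    light-term : ∀ a → ⟦ adj G t a ∧ light a ⟧ * dg a ≤ E * ⟦ adj G t a ⟧
    light-term a with adj G t a | light a in l
    ... | false | _     = z≤n
    ... | true  | false = z≤n
    ... | true  | true  = ≤-trans (≤-reflexive (+-identityʳ _))
                            (≤-trans (<⇒≤ (<ᵇ-sound l)) (≤-reflexive (sym (*-identityʳ E))))

  candidate-covers : ∀ t → candidate t ≡ true → ∑ (covers t) ≤ P
  candidate-covers t c = begin
    ∑ (covers t)                    ≡⟨ ∑-covers t ⟩
    1 + ∑ (λ v → ⟦ conflict t v ⟧)  ≤⟨ +-mono-≤ E≥1 (conflicts-bound t) ⟩
    E + E * dg t                    ≡⟨ sym (*-suc E (dg t)) ⟩
    E * suc (dg t)                  ≤⟨ *-monoʳ-≤ E (candidate-degree t c) ⟩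
    E * D                           ≡⟨ *-comm E D ⟩
    P                               ∎
    where open ≤-Reasoning

  nX nY nS nT nCand nRichX nHeavyY costX : ℕ
  nX      = ∑ (λ v → ⟦ col v ⟧)
  nY      = ∑ (λ v → ⟦ not (col v) ⟧)
  nS      = ∑ (λ v → ⟦ inS v ⟧)
  nT      = ∑ (λ v → ⟦ chosen v ⟧)
  nCand   = ∑ (λ v → ⟦ candidate v ⟧)
  nRichX  = ∑ (λ v → ⟦ col v ∧ rich v ⟧)
  nHeavyY = ∑ (λ v → ⟦ not (col v) ∧ (D ≤ᵇ dg v) ⟧)
  costX   = ∑ (λ a → ⟦ col a ∧ medium a ⟧ * dg a)

  -- Each Y-vertex is a candidate, has degree ≥ D, or has a medium neighbour
  -- (in X); the last kind is counted by the degrees of the medium X-vertices.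
  Y-covered : nY ≤ nCand + nHeavyY + costX
  Y-covered = begin
    nY
      ≤⟨ ∑-mono Y-cases ⟩
    ∑ (λ v → ⟦ candidate v ⟧ + ⟦ not (col v) ∧ (D ≤ᵇ dg v) ⟧ + mediumX-nbrs v)
      ≡⟨ ∑-+ (λ v → ⟦ candidate v ⟧ + ⟦ not (col v) ∧ (D ≤ᵇ dg v) ⟧) mediumX-nbrs ⟩
    ∑ (λ v → ⟦ candidate v ⟧ + ⟦ not (col v) ∧ (D ≤ᵇ dg v) ⟧) + ∑ mediumX-nbrs
      ≡⟨ cong₂ _+_ (∑-+ (λ v → ⟦ candidate v ⟧) (λ v → ⟦ not (col v) ∧ (D ≤ᵇ dg v) ⟧))
                   medium-degrees ⟩
    nCand + nHeavyY + costX ∎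
    where
    open ≤-Reasoning
    mediumX-nbrs : Fin n → ℕ
    mediumX-nbrs v = ∑ (λ a → ⟦ col a ∧ medium a ⟧ * ⟦ adj G v a ⟧)
    in-degree : ∀ a → ∑ (λ v → ⟦ adj G v a ⟧) ≡ dg a
    in-degree a = ∑-cong (λ v → cong ⟦_⟧ (Graph.sym G v a))
    medium-degrees : ∑ mediumX-nbrs ≡ costX
    medium-degrees = trans (∑-swap (λ v a → ⟦ col a ∧ medium a ⟧ * ⟦ adj G v a ⟧)) (∑-cong λ a →
      trans (∑-*ˡ ⟦ col a ∧ medium a ⟧ (λ v → ⟦ adj G v a ⟧)) (cong (⟦ col a ∧ medium a ⟧ *_) (in-degree a)))
    has-mediumX-nbr : ∀ v → col v ≡ false → medium-nbr v ≡ true → 1 ≤ mediumX-nbrs v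
    has-mediumX-nbr v cv mn with any-elim (λ a → adj G v a ∧ medium a) mn
    ... | a , q with ∧-true {adj G v a} q
    ...   | va , ma =
      subst (_≤ mediumX-nbrs v) one (≤-∑ (λ a → ⟦ col a ∧ medium a ⟧ * ⟦ adj G v a ⟧) a)
      where
      one : ⟦ col a ∧ medium a ⟧ * ⟦ adj G v a ⟧ ≡ 1
      one rewrite trans (opposite va) (cong not cv) | ma | va = refl
    Y-cases : ∀ v → ⟦ not (col v) ⟧ ≤
              ⟦ candidate v ⟧ + ⟦ not (col v) ∧ (D ≤ᵇ dg v) ⟧ + mediumX-nbrs v
    Y-cases v with col v in cv | dg v <ᵇ D in low | medium-nbr v in mn
    ... | true  | _     | _     = z≤n
    ... | false | true  | false = s≤s z≤n
    ... | false | false | _     =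
      subst (λ b → 1 ≤ ⟦ b ⟧ + mediumX-nbrs v) (sym (≤ᵇ-complete (<ᵇ-false {dg v} {D} low)))
            (s≤s z≤n)
    ... | false | true  | true  = ≤-trans (has-mediumX-nbr v cv mn) (m≤n+m _ _)

  -- Every X-vertex and every chosen vertex is in S, unless it is a rich X-vertex.
  X-kept : nX + nT ≤ nS + nRichX
  X-kept = begin
    nX + nT
      ≡⟨ sym (∑-+ (λ v → ⟦ col v ⟧) (λ v → ⟦ chosen v ⟧)) ⟩
    ∑ (λ v → ⟦ col v ⟧ + ⟦ chosen v ⟧)
      ≤⟨ ∑-mono (λ v → kept (col v) (rich v) (chosen v) (chosen-in-Y v)) ⟩
    ∑ (λ v → ⟦ inS v ⟧ + ⟦ col v ∧ rich v ⟧)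
      ≡⟨ ∑-+ (λ v → ⟦ inS v ⟧) (λ v → ⟦ col v ∧ rich v ⟧) ⟩
    nS + nRichX ∎
    where
    open ≤-Reasoning
    kept : ∀ x r c → (c ≡ true → x ≡ false) →
           ⟦ x ⟧ + ⟦ c ⟧ ≤ ⟦ (x ∧ not r) ∨ c ⟧ + ⟦ x ∧ r ⟧
    kept true  r     true  h with h refl
    ... | ()
    kept true  true  false h = s≤s z≤n
    kept true  false false h = s≤s z≤n
    kept false r     true  h = s≤s z≤n
    kept false r     false h = z≤n

  side-inequality : P * nX + nY ≤ P * nS + P * nRichX + nHeavyY + costX
  side-inequality = begin
    P * nX + nY
      ≤⟨ +-monoʳ-≤ (P * nX) Y-covered ⟩
    P * nX + (nCand + nHeavyY + costX)
      ≤⟨ +-monoʳ-≤ (P * nX) (+-monoˡ-≤ costX (+-monoˡ-≤ nHeavyY (greedy-count P candidate-covers))) ⟩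
    P * nX + (P * nT + nHeavyY + costX)
      ≡⟨ solve 5 (λ p x t h c → p :* x :+ (p :* t :+ h :+ c) := p :* (x :+ t) :+ h :+ c)
           refl P nX nT nHeavyY costX ⟩
    P * (nX + nT) + nHeavyY + costX
      ≤⟨ +-monoˡ-≤ costX (+-monoˡ-≤ nHeavyY (*-monoʳ-≤ P X-kept)) ⟩
    P * (nS + nRichX) + nHeavyY + costX
      ≡⟨ cong (λ x → x + nHeavyY + costX) (*-distribˡ-+ P nS nRichX) ⟩
    P * nS + P * nRichX + nHeavyY + costX ∎
    where open ≤-Reasoning

-- The cost charged to a vertex of degree g at threshold E (with P = D·E):
-- a rich vertex costs P (it is removed from X), a medium one its degree (it
-- excludes its neighbours from the candidates), a light one nothing.
layerCost : ℕ → ℕ → ℕ → ℕ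
layerCost E P g = if P ≤ᵇ g then P else (if E ≤ᵇ g then g else 0)

layerCost-bound : ∀ E P g →
                  P * ⟦ P ≤ᵇ g ⟧ + ⟦ (E ≤ᵇ g) ∧ (g <ᵇ P) ⟧ * g ≤ layerCost E P g
layerCost-bound E P g with P ≤ᵇ g in rich | E ≤ᵇ g
... | true  | true  rewrite <ᵇ-refute (≤⇒≯ (≤ᵇ-sound {P} rich)) =
  ≤-reflexive (trans (+-identityʳ _) (*-identityʳ P))
... | true  | false = ≤-reflexive (trans (+-identityʳ _) (*-identityʳ P))
... | false | false = ≤-reflexive (trans (+-identityʳ _) (*-zeroʳ P))
... | false | true  rewrite <ᵇ-complete (≤ᵇ-false {P} rich) | *-zeroʳ P =
  ≤-reflexive (+-identityʳ g)

≤-twice : ∀ {a b c} → a ≤ c → b ≤ c → a + b ≤ 2 * c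
≤-twice {c = c} a≤c b≤c =
  ≤-trans (+-mono-≤ a≤c b≤c) (≤-reflexive (cong (c +_) (sym (+-identityʳ c))))

absorb-errors : ∀ P n s c h → P * n + n ≤ P * s + c + h → 2 * c ≤ n → 4 * h ≤ n →
                4 * P * n + n ≤ 4 * P * s
absorb-errors P n s c h main 2c≤n 4h≤n = +-cancelʳ-≤ (3 * n) _ _ (begin
  4 * P * n + n + 3 * n
    ≡⟨ solve 2 (λ p n → con 4 :* p :* n :+ n :+ con 3 :* n := con 4 :* (p :* n :+ n)) refl P n ⟩
  4 * (P * n + n)
    ≤⟨ *-monoʳ-≤ 4 main ⟩
  4 * (P * s + c + h)
    ≡⟨ solve 4 (λ p s c h → con 4 :* (p :* s :+ c :+ h)
                            := con 4 :* p :* s :+ (con 2 :* (con 2 :* c) :+ con 4 :* h)) refl P s c h ⟩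
  4 * P * s + (2 * (2 * c) + 4 * h)
    ≤⟨ +-monoʳ-≤ (4 * P * s) (+-mono-≤ (*-monoʳ-≤ 2 2c≤n) 4h≤n) ⟩
  4 * P * s + (2 * n + n)
    ≡⟨ cong (4 * P * s +_) (solve 1 (λ n → con 2 :* n :+ n := con 3 :* n) refl n) ⟩
  4 * P * s + 3 * n ∎)
  where open ≤-Reasoning

module BothSides {n} (G : Graph n) (col : Fin n → Bool)
                 (proper : ∀ i j → Adj G i j → col i ≢ col j)
                 (D E : ℕ) (E≥1 : 1 ≤ E) where

  swapped-proper : ∀ i j → Adj G i j → not (col i) ≢ not (col j)
  swapped-proper i j e = proper i j e ∘ not-injective

  module S₁ = OneSide G col proper D E E≥1
  module S₂ = OneSide G (not ∘ col) swapped-proper D E E≥1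

  P : ℕ
  P = D * E

  cost nHeavy : ℕ
  cost   = ∑ (λ v → layerCost E P (deg G v))
  nHeavy = ∑ (λ v → ⟦ D ≤ᵇ deg G v ⟧)

  -- the two side inequalities added up; every vertex is on exactly one side
  both-sides : P * n + n ≤ P * (S₁.nS + S₂.nS) + cost + nHeavy
  both-sides = begin
    P * n + n
      ≡⟨ cong₂ (λ a b → P * a + b) (sym eX) (sym eY) ⟩
    P * (S₁.nX + S₂.nX) + (S₁.nY + S₂.nY)
      ≡⟨ solve 5 (λ p a b c e → p :* (a :+ b) :+ (c :+ e) := (p :* a :+ c) :+ (p :* b :+ e))
           refl P S₁.nX S₂.nX S₁.nY S₂.nY ⟩
    (P * S₁.nX + S₁.nY) + (P * S₂.nX + S₂.nY)
      ≤⟨ +-mono-≤ S₁.side-inequality S₂.side-inequality ⟩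
    (P * S₁.nS + P * S₁.nRichX + S₁.nHeavyY + S₁.costX) +
    (P * S₂.nS + P * S₂.nRichX + S₂.nHeavyY + S₂.costX)
      ≡⟨ solve 9 (λ p a b c e a′ b′ c′ e′ →
             (p :* a :+ p :* b :+ c :+ e) :+ (p :* a′ :+ p :* b′ :+ c′ :+ e′)
             := p :* (a :+ a′) :+ (p :* (b :+ b′) :+ (e :+ e′)) :+ (c :+ c′)) refl
             P S₁.nS S₁.nRichX S₁.nHeavyY S₁.costX S₂.nS S₂.nRichX S₂.nHeavyY S₂.costX ⟩
    P * (S₁.nS + S₂.nS) + (P * (S₁.nRichX + S₂.nRichX) + (S₁.costX + S₂.costX)) +
    (S₁.nHeavyY + S₂.nHeavyY)
      ≤⟨ +-mono-≤ (+-monoʳ-≤ (P * (S₁.nS + S₂.nS)) charged) (≤-reflexive eH) ⟩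
    P * (S₁.nS + S₂.nS) + cost + nHeavy ∎
    where
    open ≤-Reasoning
    dg = deg G
    rich medium : Fin n → Bool
    rich   v = P ≤ᵇ dg v
    medium v = (E ≤ᵇ dg v) ∧ (dg v <ᵇ P)
    partition : {f g h : Fin n → ℕ} → (∀ v → f v + g v ≡ h v) → ∑ f + ∑ g ≡ ∑ h
    partition {f} {g} e = trans (sym (∑-+ f g)) (∑-cong e)
    all-ones : ∑ {n} (λ _ → 1) ≡ n
    all-ones = trans (∑-const {n} 1) (*-identityʳ n)
    eX : S₁.nX + S₂.nX ≡ n
    eX = trans (partition (λ v → ⟦⟧-split₁ (col v))) all-ones
    eY : S₁.nY + S₂.nY ≡ n
    eY = trans (partition (λ v → ⟦⟧-split₁ (not (col v)))) all-ones
    eH : S₁.nHeavyY + S₂.nHeavyY ≡ nHeavy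
    eH = partition (λ v → ⟦⟧-split (not (col v)) (D ≤ᵇ dg v))
    eR : S₁.nRichX + S₂.nRichX ≡ ∑ (λ v → ⟦ rich v ⟧)
    eR = partition (λ v → ⟦⟧-split (col v) (rich v))
    eC : S₁.costX + S₂.costX ≡ ∑ (λ v → ⟦ medium v ⟧ * dg v)
    eC = partition (λ v → trans (sym (*-distribʳ-+ (dg v) ⟦ col v ∧ medium v ⟧ _))
                                (cong (_* dg v) (⟦⟧-split (col v) (medium v))))
    charged : P * (S₁.nRichX + S₂.nRichX) + (S₁.costX + S₂.costX) ≤ cost
    charged = begin
      P * (S₁.nRichX + S₂.nRichX) + (S₁.costX + S₂.costX)
        ≡⟨ cong₂ (λ a b → P * a + b) eR eC ⟩
      P * ∑ (λ v → ⟦ rich v ⟧) + ∑ (λ v → ⟦ medium v ⟧ * dg v)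
        ≡⟨ cong (_+ ∑ (λ v → ⟦ medium v ⟧ * dg v)) (sym (∑-*ˡ P (λ v → ⟦ rich v ⟧))) ⟩
      ∑ (λ v → P * ⟦ rich v ⟧) + ∑ (λ v → ⟦ medium v ⟧ * dg v)
        ≡⟨ sym (∑-+ (λ v → P * ⟦ rich v ⟧) (λ v → ⟦ medium v ⟧ * dg v)) ⟩
      ∑ (λ v → P * ⟦ rich v ⟧ + ⟦ medium v ⟧ * dg v)
        ≤⟨ ∑-mono (λ v → layerCost-bound E P (dg v)) ⟩
      cost ∎

  larger-side : 2 * cost ≤ n → 4 * nHeavy ≤ n →
                Σ (Subset n) λ S → 4 * P * n + n ≤ 8 * P * ∣ S ∣ × StarForest G S
  larger-side 2c≤n 4h≤n = pick (S₁.nS ≤? S₂.nS)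
    where
    large : (s : Fin n → Bool) → S₁.nS + S₂.nS ≤ 2 * ∑ (λ v → ⟦ s v ⟧) →
            4 * P * n + n ≤ 8 * P * ∣ tabulate s ∣
    large s ≤2s rewrite ∣tabulate∣ s =
      ≤-trans (absorb-errors P n (S₁.nS + S₂.nS) cost nHeavy both-sides 2c≤n 4h≤n)
              (≤-trans (*-monoʳ-≤ (4 * P) ≤2s)
                       (≤-reflexive (solve 2 (λ p s → con 4 :* p :* (con 2 :* s) := con 8 :* p :* s)
                                       refl P (∑ (λ v → ⟦ s v ⟧)))))
    pick : Dec (S₁.nS ≤ S₂.nS) →
           Σ (Subset n) λ S → 4 * P * n + n ≤ 8 * P * ∣ S ∣ × StarForest G S
    pick (yes ≤S₂) = tabulate S₂.inS , large S₂.inS (≤-twice ≤S₂ ≤-refl) , S₂.forest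
    pick (no  ≰S₂) =
      tabulate S₁.inS , large S₁.inS (≤-twice ≤-refl (<⇒≤ (≰⇒> ≰S₂))) , S₁.forest

-- Summed over the layers k < K, the costs of a
-- vertex of degree g are at most 3g: the layers with D^(k+1) ≤ g contribute a
-- geometric series below 2g, the (at most one) layer with D^k ≤ g < D^(k+1)
-- contributes g, and all later layers nothing.

sumTo : ℕ → (ℕ → ℕ) → ℕ
sumTo zero    h = 0
sumTo (suc K) h = sumTo K h + h K

costAt : ℕ → ℕ → ℕ → ℕ
costAt D k g = layerCost (D ^ k) (D * D ^ k) g

-- One step of the invariant of 'layers-below', for a = (D^K ≤ g) and
-- b = (D^(K+1) ≤ g).
layer-step : ∀ D → 2 ≤ D → ∀ g DK s (a b : Bool) →
  (a ≡ true → DK ≤ g) → (a ≡ false → g < DK) → (b ≡ true → D * DK ≤ g) →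
  s ≤ (if a then 2 * DK else 3 * g) →
  s + (if b then D * DK else (if a then g else 0)) ≤ (if b then 2 * (D * DK) else 3 * g)
layer-step D D≥2 g DK s true true _ _ _ s≤ =
  ≤-trans (+-monoˡ-≤ (D * DK) (≤-trans s≤ (*-monoˡ-≤ DK D≥2)))
          (≤-reflexive (cong (D * DK +_) (sym (+-identityʳ _))))
layer-step D D≥2 g DK s true false DK≤g _ _ s≤ =
  ≤-trans (+-monoˡ-≤ g (≤-trans s≤ (*-monoʳ-≤ 2 (DK≤g refl)))) (≤-reflexive (+-comm (2 * g) g))
layer-step D@(suc _) D≥2 g DK s false true _ g<DK DDK≤g _ =
  ⊥-elim (<⇒≱ (g<DK refl) (≤-trans (m≤n*m DK D) (DDK≤g refl)))
layer-step D D≥2 g DK s false false _ _ _ s≤ = ≤-trans (≤-reflexive (+-identityʳ s)) s≤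

layers-below : ∀ D → 2 ≤ D → ∀ g K →
  sumTo K (λ k → costAt D k g) ≤ (if D ^ K ≤ᵇ g then 2 * D ^ K else 3 * g)
layers-below D D≥2 g zero    = z≤n
layers-below D D≥2 g (suc K) =
  layer-step D D≥2 g (D ^ K) _ (D ^ K ≤ᵇ g) (D * D ^ K ≤ᵇ g)
    ≤ᵇ-sound (≤ᵇ-false {D ^ K}) (≤ᵇ-sound {D * D ^ K}) (layers-below D D≥2 g K)

layer-sum : ∀ D → 2 ≤ D → ∀ g K → sumTo K (λ k → costAt D k g) ≤ 3 * g
layer-sum D D≥2 g K with D ^ K ≤ᵇ g in DK≤g | layers-below D D≥2 g K
... | false | bound = bound
... | true  | bound =
  ≤-trans bound (≤-trans (*-monoʳ-≤ 2 (≤ᵇ-sound {D ^ K} DK≤g)) (*-monoˡ-≤ g (n≤1+n 2)))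

sumTo-∑ : ∀ {n} K (f : ℕ → Fin n → ℕ) →
          sumTo K (λ k → ∑ (f k)) ≡ ∑ (λ v → sumTo K (λ k → f k v))
sumTo-∑ {n} zero    f = sym (∑-zero {n})
sumTo-∑     (suc K) f = trans (cong (_+ ∑ (f K)) (sumTo-∑ K f))
                              (sym (∑-+ (λ v → sumTo K (λ k → f k v)) (f K)))

below-average : ∀ K (h : ℕ → ℕ) → ∃ λ k → k < suc K × suc K * h k ≤ sumTo (suc K) h
below-average zero    h = 0 , s≤s z≤n , ≤-reflexive (+-identityʳ (h 0))
below-average (suc K) h with below-average K h
... | k , k<1+K , avg with h k ≤? h (suc K)
...   | yes hk≤ = k , m<n⇒m<1+n k<1+K , (begin
        h k + suc K * h k              ≤⟨ +-mono-≤ hk≤ avg ⟩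
        h (suc K) + sumTo (suc K) h    ≡⟨ +-comm (h (suc K)) _ ⟩
        sumTo (suc (suc K)) h          ∎)
  where open ≤-Reasoning
...   | no  hk≰ = let hk> = <⇒≤ (≰⇒> hk≰) in suc K , ≤-refl , (begin
        h (suc K) + suc K * h (suc K)  ≤⟨ +-monoʳ-≤ (h (suc K)) (≤-trans (*-monoʳ-≤ (suc K) hk>) avg) ⟩
        h (suc K) + sumTo (suc K) h    ≡⟨ +-comm (h (suc K)) _ ⟩
        sumTo (suc (suc K)) h          ∎)
  where open ≤-Reasoning

good-layer : ∀ {n} D → 2 ≤ D → ∀ K → 1 ≤ K → (g : Fin n → ℕ) →
             ∃ λ k → k < K × K * ∑ (λ v → costAt D k (g v)) ≤ 3 * ∑ g
good-layer D D≥2 (suc K) _ g with below-average K (λ k → ∑ (λ v → costAt D k (g v)))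
... | k , k<K , avg = k , k<K , (begin
  suc K * ∑ (λ v → costAt D k (g v))
    ≤⟨ avg ⟩
  sumTo (suc K) (λ k → ∑ (λ v → costAt D k (g v)))
    ≡⟨ sumTo-∑ (suc K) (λ k v → costAt D k (g v)) ⟩
  ∑ (λ v → sumTo (suc K) (λ k → costAt D k (g v)))
    ≤⟨ ∑-mono (λ v → layer-sum D D≥2 (g v) (suc K)) ⟩
  ∑ (λ v → 3 * g v)
    ≡⟨ ∑-*ˡ 3 g ⟩
  3 * ∑ g ∎)
  where open ≤-Reasoning

markov : ∀ {n} D (g : Fin n → ℕ) → D * ∑ (λ v → ⟦ D ≤ᵇ g v ⟧) ≤ ∑ g
markov D g = ≤-trans (≤-reflexive (sym (∑-*ˡ D (λ v → ⟦ D ≤ᵇ g v ⟧)))) (∑-mono at)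
  where
  at : ∀ v → D * ⟦ D ≤ᵇ g v ⟧ ≤ g v
  at v with D ≤ᵇ g v in D≤g
  ... | false = ≤-trans (≤-reflexive (*-zeroʳ D)) z≤n
  ... | true  = ≤-trans (≤-reflexive (*-identityʳ D)) (≤ᵇ-sound D≤g)

*-^ : ∀ a b k → (a * b) ^ k ≡ a ^ k * b ^ k
*-^ a b zero    = refl
*-^ a b (suc k) = trans (cong (a * b *_) (*-^ a b k))
  (solve 4 (λ a b x y → (a :* b) :* (x :* y) := (a :* x) :* (b :* y)) refl a b (a ^ k) (b ^ k))

threshold-bound : ∀ d → 1 ≤ d → 8 * (4 * d) ^ (6 * d) ≤ deltaDen d
threshold-bound d@(suc _) 1≤d = begin
  8 * (4 * d) ^ (6 * d)                   ≤⟨ *-monoʳ-≤ 8 (^-monoʳ-≤ (4 * d) (*-monoˡ-≤ d 6≤8)) ⟩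
  8 * (4 * d) ^ (8 * d)                   ≡⟨ cong (λ e → 8 * (4 * d) ^ e) (*-assoc 2 4 d) ⟩
  8 * (4 * d) ^ (2 * (4 * d))             ≡⟨ cong (8 *_) (sym (^-*-assoc (4 * d) 2 (4 * d))) ⟩
  8 * ((4 * d) ^ 2) ^ (4 * d)             ≡⟨ cong (λ x → 8 * x ^ (4 * d)) square ⟩
  8 * (16 * (d * d)) ^ (4 * d)            ≤⟨ *-monoˡ-≤ _ (^-monoʳ-≤ 8 (≤-trans 1≤d (m≤n*m d 4))) ⟩
  8 ^ (4 * d) * (16 * (d * d)) ^ (4 * d)  ≡⟨ sym (*-^ 8 (16 * (d * d)) (4 * d)) ⟩
  (8 * (16 * (d * d))) ^ (4 * d)          ≡⟨ cong (_^ (4 * d)) (sym (*-assoc 8 16 (d * d))) ⟩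
  deltaDen d                              ∎
  where
  open ≤-Reasoning
  6≤8 : 6 ≤ 8
  6≤8 = +-monoˡ-≤ 6 (z≤n {2})
  square : (4 * d) ^ 2 ≡ 16 * (d * d)
  square = solve 1 (λ x → (con 4 :* x) :* ((con 4 :* x) :* con 1) := con 16 :* (x :* x)) refl d

rescale : ∀ M P n s → 1 ≤ P → 8 * P ≤ M → 4 * P * n + n ≤ 8 * P * s →
          M * n + 2 * n ≤ 2 * M * s
rescale M P@(suc _) n s _ 8P≤M large = *-cancelˡ-≤ (4 * P) (begin
  4 * P * (M * n + 2 * n)     ≡⟨ solve 3 (λ p m n → con 4 :* p :* (m :* n :+ con 2 :* n)
                                               := m :* (con 4 :* p :* n) :+ con 8 :* p :* n) refl P M n ⟩
  M * (4 * P * n) + 8 * P * n ≤⟨ +-monoʳ-≤ (M * (4 * P * n)) (*-monoˡ-≤ n 8P≤M) ⟩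
  M * (4 * P * n) + M * n     ≡⟨ sym (*-distribˡ-+ M (4 * P * n) n) ⟩
  M * (4 * P * n + n)         ≤⟨ *-monoʳ-≤ M large ⟩
  M * (8 * P * s)             ≡⟨ solve 3 (λ p m s → m :* (con 8 :* p :* s)
                                                 := con 4 :* p :* (con 2 :* m :* s)) refl P M s ⟩
  4 * P * (2 * M * s)         ∎)
  where open ≤-Reasoning

cancel-cost : ∀ d n c → 1 ≤ d → 6 * d * c ≤ 3 * (d * n) → 2 * c ≤ n
cancel-cost d@(suc _) n c _ bound = *-cancelˡ-≤ (3 * d) (begin
  3 * d * (2 * c)  ≡⟨ solve 2 (λ d c → con 3 :* d :* (con 2 :* c) := con 6 :* d :* c) refl d c ⟩
  6 * d * c        ≤⟨ bound ⟩
  3 * (d * n)      ≡⟨ sym (*-assoc 3 d n) ⟩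
  3 * d * n        ∎)
  where open ≤-Reasoning

cancel-heavy : ∀ d n h → 1 ≤ d → 4 * d * h ≤ d * n → 4 * h ≤ n
cancel-heavy d@(suc _) n h _ bound =
  *-cancelˡ-≤ d (≤-trans (≤-reflexive (solve 2 (λ d h → d :* (con 4 :* h) := con 4 :* d :* h) refl d h)) bound)

theorem2p1 : (d : ℕ) → 1 ≤ d → (n : ℕ) → (G : Graph n) →
    Bipartite G → AvgDegreeAtMost G d →
    Σ (Subset n) λ S → LargeEnough d n ∣ S ∣ × StarForest G S
theorem2p1 zero () _ _ _ _
theorem2p1 d@(suc _) 1≤d n G (col , proper) avg =
  S , rescale (deltaDen d) P n ∣ S ∣ (m^n>0 D (suc k)) 8P≤M (proj₁ (proj₂ chosen)) ,
  proj₂ (proj₂ chosen)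
  where
  D = 4 * d
  ∑deg≤dn : ∑ (deg G) ≤ d * n
  ∑deg≤dn = ≤-trans (≤-reflexive (handshake G)) avg
  layer : ∃ λ k → k < 6 * d × 6 * d * ∑ (λ v → costAt D k (deg G v)) ≤ 3 * ∑ (deg G)
  layer = good-layer D (≤-trans (s≤s (s≤s z≤n)) (*-monoʳ-≤ 4 1≤d)) (6 * d) (s≤s z≤n) (deg G)
  k = proj₁ layer
  open BothSides G col proper D (D ^ k) (m^n>0 D k) using (P; cost; nHeavy; larger-side)
  cheap : 2 * cost ≤ n
  cheap = cancel-cost d n cost 1≤d (≤-trans (proj₂ (proj₂ layer)) (*-monoʳ-≤ 3 ∑deg≤dn))
  few-heavy : 4 * nHeavy ≤ n
  few-heavy = cancel-heavy d n nHeavy 1≤d (≤-trans (markov D (deg G)) ∑deg≤dn)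
  chosen : Σ (Subset n) λ S → 4 * P * n + n ≤ 8 * P * ∣ S ∣ × StarForest G S
  chosen = larger-side cheap few-heavy
  S : Subset n
  S = proj₁ chosen
  8P≤M : 8 * P ≤ deltaDen d
  8P≤M = ≤-trans (*-monoʳ-≤ 8 (^-monoʳ-≤ D (proj₁ (proj₂ layer)))) (threshold-bound d 1≤d)
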